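{- Let $F$ be a recursively enumerable formal system and let $\mathcal{G}_F$ be as in the context. Then $\mathcal{G}_F$ is a computable function class, i.e., there is a total computable function $G_F:\mathbb{N}\times\mathbb{N}\to\{0,1\}$ with $\mathcal{G}_F=\{n\mapsto G_F(m,n): m\in\mathbb{N}\}$.
   Context: Let $\mathbb{N}=\{0,1,2,\dots\}$. Fix a Gödel numbering of statements of the formal system $F$ such that translating between statements and Gödel numbers, and forming negations, is primitive recursive. $F$ is recursively enumerable if there is a primitive recursive $\varphi:\mathbb{N}\to\mathbb{N}$ whose range is exactly the set of Gödel numbers of statements provable in $F$; fix such $\varphi$. Standing assumption: infinitely many different theorems are provable in $F$. Let $E^2:\mathbb{N}\to\mathbb{N}\times\mathbb{N}$ be a bijection with primitive recursive components $E^2_1,E^2_2$ and primitive recursive inverse. Let $c_c(\{0,1\})$ be the set of finitely supported $a:\mathbb{N}\to\{0,1\}$. For such $a$ let $g_a(n)=a(n)$ if the statement with Gödel number $\varphi(E^2_1(n))$ is the negation of the statement with Gödel number $\varphi(E^2_2(n))$, and $g_a(n)=0$ otherwise; $\mathcal{G}_F=\{g_a: a\in c_c(\{0,1\})\}$. -}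

module Defs where

open import Data.Nat using (ℕ; zero; suc; _≤_)
open import Data.Fin using (Fin)
open import Data.Vec using (Vec; []; _∷_; lookup)
open import Data.Product using (Σ; ∃; _×_; _,_)
open import Relation.Binary.PropositionalEquality using (_≡_)
open import Relation.Nullary using (¬_)

data PR : ℕ → Set where
  zeroF : ∀ {n} → PR n
  succF : PR 1
  projF : ∀ {n} → Fin n → PR n
  compF : ∀ {m n} → PR m → Vec (PR n) m → PR n
  precF : ∀ {n} → PR n → PR (suc (suc n)) → PR (suc n)

mutual
  evalPR : ∀ {n} → PR n → Vec ℕ n → ℕ
  evalPR zeroF xs = 0
  evalPR succF (x ∷ []) = suc x
  evalPR (projF i) xs = lookup xs i
  evalPR (compF f gs) xs = evalPR f (evalPRs gs xs)
  evalPR (precF g h) (zero ∷ xs) = evalPR g xs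
  evalPR (precF g h) (suc k ∷ xs) = evalPR h (k ∷ evalPR (precF g h) (k ∷ xs) ∷ xs)

  evalPRs : ∀ {m n} → Vec (PR n) m → Vec ℕ n → Vec ℕ m
  evalPRs [] xs = []
  evalPRs (g ∷ gs) xs = evalPR g xs ∷ evalPRs gs xs

IsPR₁ : (ℕ → ℕ) → Set
IsPR₁ f = Σ (PR 1) λ c → ∀ x → evalPR c (x ∷ []) ≡ f x

IsPR₂ : (ℕ → ℕ → ℕ) → Set
IsPR₂ f = Σ (PR 2) λ c → ∀ x y → evalPR c (x ∷ y ∷ []) ≡ f x y

data Rec : ℕ → Set where
  zeroR : ∀ {n} → Rec n
  succR : Rec 1
  projR : ∀ {n} → Fin n → Rec n
  compR : ∀ {m n} → Rec m → Vec (Rec n) m → Rec n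
  precR : ∀ {n} → Rec n → Rec (suc (suc n)) → Rec (suc n)
  muR   : ∀ {n} → Rec (suc n) → Rec n

mutual
  data Eval : ∀ {n} → Rec n → Vec ℕ n → ℕ → Set where
    eZero : ∀ {n} {xs : Vec ℕ n} → Eval zeroR xs 0
    eSucc : ∀ {x} → Eval succR (x ∷ []) (suc x)
    eProj : ∀ {n} {xs : Vec ℕ n} (i : Fin n) → Eval (projR i) xs (lookup xs i)
    eComp : ∀ {m n} {f : Rec m} {gs : Vec (Rec n)  m} {xs : Vec ℕ n} {ys : Vec ℕ m} {v} →
            EvalAll gs xs ys → Eval f ys v → Eval (compR f gs) xs v
    ePrec0 : ∀ {n} {g : Rec n} {h : Rec (suc (suc n))} {xs : Vec ℕ n} {v} →
             Eval g xs v → Eval (precR g h) (zero ∷ xs) v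
    ePrecS : ∀ {n} {g : Rec n} {h : Rec (suc (suc n))} {xs : Vec ℕ n} {k u v} →
             Eval (precR g h) (k ∷ xs) u → Eval h (k ∷ u ∷ xs) v →
             Eval (precR g h) (suc k ∷ xs) v
    eMu : ∀ {n} {f : Rec (suc n)} {xs : Vec ℕ n} {y} →
          Eval f (y ∷ xs) 0 → MuBelow f xs y → Eval (muR f) xs y

  data EvalAll : ∀ {m n} → Vec (Rec n) m → Vec ℕ n → Vec ℕ m → Set where
    []ₑ  : ∀ {n} {xs : Vec ℕ n} → EvalAll [] xs []
    _∷ₑ_ : ∀ {m n} {g : Rec n} {gs : Vec (Rec n) m} {xs : Vec ℕ n} {y ys} →
           Eval g xs y → EvalAll gs xs ys → EvalAll (g ∷ gs) xs (y ∷ ys)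

  data MuBelow : ∀ {n} → Rec (suc n) → Vec ℕ n → ℕ → Set where
    mb0 : ∀ {n} {f : Rec (suc n)} {xs : Vec ℕ n} → MuBelow f xs zero
    mbS : ∀ {n} {f : Rec (suc n)} {xs : Vec ℕ n} {y w} →
          MuBelow f xs y → Eval f (y ∷ xs) (suc w) → MuBelow f xs (suc y)

Computable₂ : (ℕ → ℕ → ℕ) → Set
Computable₂ G = Σ (Rec 2) λ c → ∀ m n → Eval c (m ∷ n ∷ []) (G m n)

InCc : (ℕ → ℕ) → Set
InCc a = (∀ n → a n ≤ 1) × (∃ λ N → ∀ n → N ≤ n → a n ≡ 0)

module GF (Stmt : Set) (gn : Stmt → ℕ) (neg : Stmt → Stmt)
          (φ E₁ E₂ : ℕ → ℕ) where

  NegPair : ℕ → Set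
  NegPair n = Σ Stmt λ s → Σ Stmt λ t →
              gn s ≡ φ (E₁ n) × gn t ≡ φ (E₂ n) × s ≡ neg t

  IsG : (ℕ → ℕ) → (ℕ → ℕ) → Set
  IsG a h = ∀ n → (NegPair n → h n ≡ a n) × (¬ NegPair n → h n ≡ 0)

  InGF : (ℕ → ℕ) → Set
  InGF h = Σ (ℕ → ℕ) λ a → InCc a × IsG a h

-- G_F(m, n) is the n-th binary digit of m, masked to 0 unless the n-th pair
-- (φ(E₁ n), φ(E₂ n)) consists of a statement and its negation, which is a
-- primitive recursive test on Gödel numbers. So G_F is primitive recursive,
-- hence computable. The digit sequence of any m is finitely supported, and
-- every finitely supported 0/1 sequence is the digit sequence of some m, so
-- the rows G_F(m, ·) are exactly the functions g_a.
module Submission where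

open import Defs
open import Data.Nat.Base
  using (ℕ; zero; suc; pred; _+_; _*_; _∸_; _≤_; z≤n; s≤s; s≤s⁻¹; ⌊_/2⌋; ⌈_/2⌉; ∣_-_∣)
open import Data.Nat.GeneralisedArithmetic using (fold; iterate; +-is-fold; iterate-is-fold)
open import Data.Nat.Properties
open import Data.Fin.Base using () renaming (zero to #0; suc to #suc)
open import Data.Vec.Base using (Vec; []; _∷_)
open import Data.Product.Base using (Σ; ∃; _×_; _,_)
open import Function.Base using (_∘_)
open import Function.Definitions using (Injective)
open import Relation.Binary.PropositionalEquality

mutual
  toRec : ∀ {n} → PR n → Rec n
  toRec zeroF        = zeroR
  toRec succF        = succR
  toRec (projF i)    = projR i
  toRec (compF f gs) = compR (toRec f) (toRecs gs)
  toRec (precF g h)  = precR (toRec g) (toRec h)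

  toRecs : ∀ {m n} → Vec (PR n) m → Vec (Rec n) m
  toRecs []       = []
  toRecs (g ∷ gs) = toRec g ∷ toRecs gs

mutual
  toRec-correct : ∀ {n} (c : PR n) xs → Eval (toRec c) xs (evalPR c xs)
  toRec-correct zeroF        xs       = eZero
  toRec-correct succF        (x ∷ []) = eSucc
  toRec-correct (projF i)    xs       = eProj i
  toRec-correct (compF f gs) xs       = eComp (toRecs-correct gs xs) (toRec-correct f _)
  toRec-correct (precF g h)  (k ∷ xs) = precR-correct g h k xs

  precR-correct : ∀ {n} (g : PR n) (h : PR (suc (suc n))) k xs →
                  Eval (toRec (precF g h)) (k ∷ xs) (evalPR (precF g h) (k ∷ xs))
  precR-correct g h zero    xs = ePrec0 (toRec-correct g xs)
  precR-correct g h (suc k) xs = ePrecS (precR-correct g h k xs) (toRec-correct h _)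

  toRecs-correct : ∀ {m n} (gs : Vec (PR n) m) xs → EvalAll (toRecs gs) xs (evalPRs gs xs)
  toRecs-correct []       xs = []ₑ
  toRecs-correct (g ∷ gs) xs = toRec-correct g xs ∷ₑ toRecs-correct gs xs

isPR₂⇒computable₂ : ∀ {f} → IsPR₂ f → Computable₂ f
isPR₂⇒computable₂ (c , c-correct) =
  toRec c , λ x y → subst (Eval (toRec c) _) (c-correct x y) (toRec-correct c _)

isPR₂-cong : ∀ {f g} → (∀ x y → f x y ≡ g x y) → IsPR₂ f → IsPR₂ g
isPR₂-cong f≗g (c , c-correct) = c , λ x y → trans (c-correct x y) (f≗g x y)

isPR₂-proj₁ : IsPR₂ (λ x y → x)
isPR₂-proj₁ = projF #0 , λ x y → refl

isPR₂-proj₂ : IsPR₂ (λ x y → y)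
isPR₂-proj₂ = projF (#suc #0) , λ x y → refl

isPR₁-∘ : ∀ {f g} → IsPR₁ f → IsPR₁ g → IsPR₁ (f ∘ g)
isPR₁-∘ {f} (cf , cf-correct) (cg , cg-correct) =
  compF cf (cg ∷ []) , λ x → trans (cf-correct _) (cong f (cg-correct x))

isPR₂-∘₁ : ∀ {f g} → IsPR₁ f → IsPR₂ g → IsPR₂ (λ x y → f (g x y))
isPR₂-∘₁ {f} (cf , cf-correct) (cg , cg-correct) =
  compF cf (cg ∷ []) , λ x y → trans (cf-correct _) (cong f (cg-correct x y))

isPR₂-∘₂ : ∀ {f g h} → IsPR₂ f → IsPR₂ g → IsPR₂ h → IsPR₂ (λ x y → f (g x y) (h x y))
isPR₂-∘₂ {f} (cf , cf-correct) (cg , cg-correct) (ch , ch-correct) =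
  compF cf (cg ∷ ch ∷ []) ,
  λ x y → trans (cf-correct _ _) (cong₂ f (cg-correct x y) (ch-correct x y))

isPR₁-∘₂ : ∀ {f g h} → IsPR₂ f → IsPR₁ g → IsPR₁ h → IsPR₁ (λ x → f (g x) (h x))
isPR₁-∘₂ {f} (cf , cf-correct) (cg , cg-correct) (ch , ch-correct) =
  compF cf (cg ∷ ch ∷ []) ,
  λ x → trans (cf-correct _ _) (cong₂ f (cg-correct x) (ch-correct x))

isPR₁-rec : ∀ {f h} → IsPR₂ h → f 0 ≡ 0 → (∀ k → f (suc k) ≡ h k (f k)) → IsPR₁ f
isPR₁-rec {f} {h} (ch , ch-correct) f0 fsuc = precF zeroF ch , correct
  where
  correct : ∀ k → evalPR (precF zeroF ch) (k ∷ []) ≡ f k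
  correct zero    = sym f0
  correct (suc k) = trans (ch-correct k _) (trans (cong (h k) (correct k)) (sym (fsuc k)))

isPR₂-fold : ∀ {s} → IsPR₁ s → IsPR₂ (λ k x → fold x s k)
isPR₂-fold {s} (cs , cs-correct) = precF (projF #0) (compF cs (projF (#suc #0) ∷ [])) , correct
  where
  correct : ∀ k x → evalPR (precF (projF #0) (compF cs (projF (#suc #0) ∷ []))) (k ∷ x ∷ []) ≡ fold x s k
  correct zero    x = refl
  correct (suc k) x = trans (cs-correct _) (cong s (correct k x))

isPR₁-suc : IsPR₁ suc
isPR₁-suc = succF , λ x → refl

isPR₁-pred : IsPR₁ pred
isPR₁-pred = isPR₁-rec isPR₂-proj₁ refl (λ k → refl)

isPR₂-+ : IsPR₂ _+_
isPR₂-+ = isPR₂-cong (λ k x → +-is-fold k) (isPR₂-fold isPR₁-suc)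

fold-pred≡∸ : ∀ k x → fold x pred k ≡ x ∸ k
fold-pred≡∸ zero    x = refl
fold-pred≡∸ (suc k) x = trans (cong pred (fold-pred≡∸ k x)) (pred[m∸n]≡m∸[1+n] x k)

isPR₂-∸ : IsPR₂ _∸_
isPR₂-∸ = isPR₂-cong (λ x y → fold-pred≡∸ y x)
                     (isPR₂-∘₂ (isPR₂-fold isPR₁-pred) isPR₂-proj₂ isPR₂-proj₁)

∸+∸≡∣-∣ : ∀ x y → (x ∸ y) + (y ∸ x) ≡ ∣ x - y ∣
∸+∸≡∣-∣ zero    zero    = refl
∸+∸≡∣-∣ zero    (suc y) = refl
∸+∸≡∣-∣ (suc x) zero    = +-identityʳ (suc x)
∸+∸≡∣-∣ (suc x) (suc y) = ∸+∸≡∣-∣ x y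

isPR₂-∣-∣ : IsPR₂ ∣_-_∣
isPR₂-∣-∣ = isPR₂-cong ∸+∸≡∣-∣
  (isPR₂-∘₂ isPR₂-+ (isPR₂-∘₂ isPR₂-∸ isPR₂-proj₁ isPR₂-proj₂)
                    (isPR₂-∘₂ isPR₂-∸ isPR₂-proj₂ isPR₂-proj₁))

⌈n/2⌉≡n∸⌊n/2⌋ : ∀ n → ⌈ n /2⌉ ≡ n ∸ ⌊ n /2⌋
⌈n/2⌉≡n∸⌊n/2⌋ n = begin
  ⌈ n /2⌉                       ≡⟨ m+n∸m≡n ⌊ n /2⌋ ⌈ n /2⌉ ⟨
  ⌊ n /2⌋ + ⌈ n /2⌉ ∸ ⌊ n /2⌋   ≡⟨ cong (_∸ ⌊ n /2⌋) (⌊n/2⌋+⌈n/2⌉≡n n) ⟩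
  n ∸ ⌊ n /2⌋                   ∎
  where open ≡-Reasoning

-- ⌈ n /2⌉ is by definition ⌊ suc n /2⌋.
isPR₁-⌊/2⌋ : IsPR₁ ⌊_/2⌋
isPR₁-⌊/2⌋ = isPR₁-rec isPR₂-∸ refl ⌈n/2⌉≡n∸⌊n/2⌋

lsb : ℕ → ℕ
lsb m = ⌈ m /2⌉ ∸ ⌊ m /2⌋

bit : ℕ → ℕ → ℕ
bit m n = lsb (iterate ⌊_/2⌋ m n)

lsb≤1 : ∀ m → lsb m ≤ 1
lsb≤1 zero          = z≤n
lsb≤1 (suc zero)    = s≤s z≤n
lsb≤1 (suc (suc m)) = lsb≤1 m

bit≤1 : ∀ m n → bit m n ≤ 1
bit≤1 m n = lsb≤1 (iterate ⌊_/2⌋ m n)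

isPR₂-bit : IsPR₂ bit
isPR₂-bit = isPR₂-cong (λ m n → cong lsb (iterate-is-fold m ⌊_/2⌋ n))
  (isPR₂-∘₁ (isPR₁-∘₂ isPR₂-∸ (isPR₁-∘ isPR₁-⌊/2⌋ isPR₁-suc) isPR₁-⌊/2⌋)
            (isPR₂-∘₂ (isPR₂-fold isPR₁-⌊/2⌋) isPR₂-proj₂ isPR₂-proj₁))

⌊n/2⌋≤pred[n] : ∀ n → ⌊ n /2⌋ ≤ pred n
⌊n/2⌋≤pred[n] zero    = z≤n
⌊n/2⌋≤pred[n] (suc n) = s≤s⁻¹ (⌊n/2⌋<n n)

iterate-⌊/2⌋-vanishes : ∀ {m} n → m ≤ n → iterate ⌊_/2⌋ m n ≡ 0
iterate-⌊/2⌋-vanishes     zero    z≤n   = refl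
iterate-⌊/2⌋-vanishes {m} (suc n) m≤1+n =
  iterate-⌊/2⌋-vanishes n (≤-trans (⌊n/2⌋≤pred[n] m) (pred-mono-≤ m≤1+n))

bit-vanishes : ∀ {m} n → m ≤ n → bit m n ≡ 0
bit-vanishes n m≤n = cong lsb (iterate-⌊/2⌋-vanishes n m≤n)

2*n≡n+n : ∀ n → 2 * n ≡ n + n
2*n≡n+n n = cong (n +_) (+-identityʳ n)

⌊2*n/2⌋≡n : ∀ n → ⌊ 2 * n /2⌋ ≡ n
⌊2*n/2⌋≡n n = trans (cong ⌊_/2⌋ (2*n≡n+n n)) (sym (n≡⌊n+n/2⌋ n))

⌈2*n/2⌉≡n : ∀ n → ⌈ 2 * n /2⌉ ≡ n
⌈2*n/2⌉≡n n = trans (cong ⌈_/2⌉ (2*n≡n+n n)) (sym (n≡⌈n+n/2⌉ n))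

⌊b+2*n/2⌋≡n : ∀ {b} n → b ≤ 1 → ⌊ b + 2 * n /2⌋ ≡ n
⌊b+2*n/2⌋≡n n z≤n       = ⌊2*n/2⌋≡n n
⌊b+2*n/2⌋≡n n (s≤s z≤n) = ⌈2*n/2⌉≡n n

lsb[b+2*n]≡b : ∀ {b} n → b ≤ 1 → lsb (b + 2 * n) ≡ b
lsb[b+2*n]≡b n z≤n       = trans (cong₂ _∸_ (⌈2*n/2⌉≡n n) (⌊2*n/2⌋≡n n)) (n∸n≡0 n)
lsb[b+2*n]≡b n (s≤s z≤n) =
  trans (cong₂ _∸_ (cong suc (⌊2*n/2⌋≡n n)) (⌈2*n/2⌉≡n n)) (m+n∸n≡m 1 n)

encode : ℕ → (ℕ → ℕ) → ℕ
encode zero    a = 0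
encode (suc N) a = a 0 + 2 * encode N (a ∘ suc)

bit-encode : ∀ N {a} → (∀ n → a n ≤ 1) → (∀ n → N ≤ n → a n ≡ 0) →
             ∀ n → bit (encode N a) n ≡ a n
bit-encode zero        a≤1 a-vanishes n       = trans (bit-vanishes n z≤n) (sym (a-vanishes n z≤n))
bit-encode (suc N) {a} a≤1 a-vanishes zero    = lsb[b+2*n]≡b (encode N (a ∘ suc)) (a≤1 0)
bit-encode (suc N) {a} a≤1 a-vanishes (suc n) =
  trans (cong (λ m → bit m n) (⌊b+2*n/2⌋≡n (encode N (a ∘ suc)) (a≤1 0)))
        (bit-encode N (a≤1 ∘ suc) (λ n N≤n → a-vanishes (suc n) (s≤s N≤n)) n)

∸∣-∣-≡ : ∀ b {x y} → x ≡ y → b ∸ ∣ x - y ∣ ≡ b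
∸∣-∣-≡ b {x} x≡y = cong (b ∸_) (m≡n⇒∣m-n∣≡0 {x} x≡y)

∸∣-∣-≢ : ∀ {b x y} → b ≤ 1 → x ≢ y → b ∸ ∣ x - y ∣ ≡ 0
∸∣-∣-≢ b≤1 x≢y = m≤n⇒m∸n≡0 (≤-trans b≤1 (n≢0⇒n>0 (x≢y ∘ ∣m-n∣≡0⇒m≡n)))

enumerateGF : (negN φ E₁ E₂ : ℕ → ℕ) → ℕ → ℕ → ℕ
enumerateGF negN φ E₁ E₂ m n = bit m n ∸ ∣ φ (E₁ n) - negN (φ (E₂ n)) ∣

isPR₂-enumerateGF : ∀ {negN φ E₁ E₂} → IsPR₁ negN → IsPR₁ φ → IsPR₁ E₁ → IsPR₁ E₂ →
                    IsPR₂ (enumerateGF negN φ E₁ E₂)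
isPR₂-enumerateGF negN-pr φ-pr E₁-pr E₂-pr =
  isPR₂-∘₂ isPR₂-∸ isPR₂-bit
    (isPR₂-∘₂ isPR₂-∣-∣ (isPR₂-∘₁ (isPR₁-∘ φ-pr E₁-pr) isPR₂-proj₂)
                        (isPR₂-∘₁ (isPR₁-∘ negN-pr (isPR₁-∘ φ-pr E₂-pr)) isPR₂-proj₂))

module _ (Stmt : Set) (gn : Stmt → ℕ) (neg : Stmt → Stmt) (negN φ E₁ E₂ : ℕ → ℕ)
         (negN-gn : ∀ s → negN (gn s) ≡ gn (neg s)) where

  open GF Stmt gn neg φ E₁ E₂

  negPair⇒≡ : ∀ {n} → NegPair n → φ (E₁ n) ≡ negN (φ (E₂ n))
  negPair⇒≡ {n} (s , t , gn[s]≡ , gn[t]≡ , s≡neg[t]) = begin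
    φ (E₁ n)         ≡⟨ gn[s]≡ ⟨
    gn s             ≡⟨ cong gn s≡neg[t] ⟩
    gn (neg t)       ≡⟨ negN-gn t ⟨
    negN (gn t)      ≡⟨ cong negN gn[t]≡ ⟩
    negN (φ (E₂ n))  ∎
    where open ≡-Reasoning

  ≡⇒negPair : Injective _≡_ _≡_ gn → (∀ k → ∃ λ s → gn s ≡ φ k) →
              ∀ {n} → φ (E₁ n) ≡ negN (φ (E₂ n)) → NegPair n
  ≡⇒negPair gn-injective φ-gödel {n} eq
    with s , gn[s]≡ ← φ-gödel (E₁ n) | t , gn[t]≡ ← φ-gödel (E₂ n) =
    s , t , gn[s]≡ , gn[t]≡ , gn-injective (begin
      gn s             ≡⟨ gn[s]≡ ⟩
      φ (E₁ n)         ≡⟨ eq ⟩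
      negN (φ (E₂ n))  ≡⟨ cong negN gn[t]≡ ⟨
      negN (gn t)      ≡⟨ negN-gn t ⟩
      gn (neg t)       ∎)
    where open ≡-Reasoning

  isG-enumerateGF : Injective _≡_ _≡_ gn → (∀ k → ∃ λ s → gn s ≡ φ k) →
                    ∀ {a m} → (∀ n → bit m n ≡ a n) → IsG a (enumerateGF negN φ E₁ E₂ m)
  isG-enumerateGF gn-injective φ-gödel {a} {m} bit≡a n =
      (λ np → trans (∸∣-∣-≡ (bit m n) (negPair⇒≡ np)) (bit≡a n))
    , (λ ¬np → ∸∣-∣-≢ (bit≤1 m n) (¬np ∘ ≡⇒negPair gn-injective φ-gödel))

theorem2p12 : (Stmt : Set) (gn : Stmt → ℕ) → Injective _≡_ _≡_ gn →
    (neg : Stmt → Stmt) →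
    (negN : ℕ → ℕ) → IsPR₁ negN → (∀ s → negN (gn s) ≡ gn (neg s)) →
    (Provable : Stmt → Set) (φ : ℕ → ℕ) → IsPR₁ φ →
    (∀ k → Σ Stmt λ s → Provable s × gn s ≡ φ k) →
    (∀ s → Provable s → ∃ λ k → φ k ≡ gn s) →
    (∀ N → Σ Stmt λ s → Provable s × N ≤ gn s) →
    (E₁ E₂ : ℕ → ℕ) (pair : ℕ → ℕ → ℕ) →
    IsPR₁ E₁ → IsPR₁ E₂ → IsPR₂ pair →
    (∀ n → pair (E₁ n) (E₂ n) ≡ n) →
    (∀ x y → E₁ (pair x y) ≡ x × E₂ (pair x y) ≡ y) →
    Σ (ℕ → ℕ → ℕ) λ G →
      Computable₂ G ×
      (∀ m n → G m n ≤ 1) ×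
      (∀ m → GF.InGF Stmt gn neg φ E₁ E₂ (G m)) ×
      (∀ a → InCc a → ∃ λ m → GF.IsG Stmt gn neg φ E₁ E₂ a (G m))
theorem2p12 Stmt gn gn-injective neg negN negN-pr negN-gn _ φ φ-pr φ-provable _ _
            E₁ E₂ _ E₁-pr E₂-pr _ _ _ =
    enumerateGF negN φ E₁ E₂
  , isPR₂⇒computable₂ (isPR₂-enumerateGF negN-pr φ-pr E₁-pr E₂-pr)
  , (λ m n → ≤-trans (m∸n≤m (bit m n) ∣ φ (E₁ n) - negN (φ (E₂ n)) ∣) (bit≤1 m n))
  , (λ m → bit m , (bit≤1 m , m , bit-vanishes) , isG (λ n → refl))
  , λ a (a≤1 , N , a-vanishes) → encode N a , isG (bit-encode N a≤1 a-vanishes)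
  where
  φ-gödel : ∀ k → ∃ λ s → gn s ≡ φ k
  φ-gödel k = let s , _ , gn[s]≡ = φ-provable k in s , gn[s]≡

  isG : ∀ {a m} → (∀ n → bit m n ≡ a n) → GF.IsG Stmt gn neg φ E₁ E₂ a (enumerateGF negN φ E₁ E₂ m)
  isG = isG-enumerateGF Stmt gn neg negN φ E₁ E₂ negN-gn gn-injective φ-gödel
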